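{- Let $R$ be a local commutative ring with unity and of characteristic $p^{\alpha}$ for some prime $p$ and integer $\alpha>0$. Let $g$ be a nonzero polynomial in $R[x]$ such that $g\in p^kR[x]\setminus p^{k+1}R[x]$ for some $k<\alpha$. Let $\hat{I}=\{r\in R: p^kr=0\}$, write $g=p^k\hat{g}$ with $\hat{g}\notin pR[x]$, and let $q$ be a monic polynomial in $R[x]$. If $q$ divides $g$ in $R[x]$, then (the image of) $q$ divides (the image of) $\hat{g}$ in $(R/(\hat{I}+pR))[x]$.
   Context: A local ring is a commutative ring with unity that has a unique maximal ideal. $pR$ denotes the ideal $\{pr: r\in R\}$ and $\hat{I}+pR$ the sum of the two ideals. -}

module Defs where

open import Level using (_⊔_)
open import Algebra.Bundles using (CommutativeRing)
open import Data.Nat using (ℕ; zero; suc; _<_)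
open import Data.Nat.Divisibility using (_∣_)
open import Data.List using (List; []; _∷_; map)
open import Data.Product using (Σ; ∃; ∃₂; _×_; _,_)
open import Relation.Unary using (Pred)
open import Relation.Nullary using (¬_)

module RingDefs {c ℓ} (R : CommutativeRing c ℓ) where
  open CommutativeRing R

  ℕ→R : ℕ → Carrier
  ℕ→R zero = 0#
  ℕ→R (suc n) = 1# + ℕ→R n

  HasChar : ℕ → Set ℓ
  HasChar n = (ℕ→R n ≈ 0#) × (∀ m → ℕ→R m ≈ 0# → n ∣ m)

  record IsIdeal (I : Pred Carrier (c ⊔ ℓ)) : Set (c ⊔ ℓ) where
    field
      resp     : ∀ {x y} → x ≈ y → I x → I y
      zero∈    : I 0#
      +-closed : ∀ {x y} → I x → I y → I (x + y)
      *-closed : ∀ r {x} → I x → I (r * x)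

  Proper : Pred Carrier (c ⊔ ℓ) → Set (c ⊔ ℓ)
  Proper I = ¬ I 1#

  IsMaximal : Pred Carrier (c ⊔ ℓ) → Set (Level.suc (c ⊔ ℓ))
  IsMaximal I = IsIdeal I × Proper I ×
    (∀ (J : Pred Carrier (c ⊔ ℓ)) → IsIdeal J → Proper J →
       (∀ x → I x → J x) → ∀ x → J x → I x)

  IsLocal : Set (Level.suc (c ⊔ ℓ))
  IsLocal = Σ (Pred Carrier (c ⊔ ℓ)) λ M → IsMaximal M ×
    (∀ (M' : Pred Carrier (c ⊔ ℓ)) → IsMaximal M' →
       (∀ x → M' x → M x) × (∀ x → M x → M' x))

  -- polynomials in R[x]: coefficient lists, lowest degree first
  Poly : Set c
  Poly = List Carrier

  coeff : Poly → ℕ → Carrier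
  coeff [] _ = 0#
  coeff (a ∷ f) zero = a
  coeff (a ∷ f) (suc i) = coeff f i

  _≈ₚ_ : Poly → Poly → Set ℓ
  f ≈ₚ g = ∀ i → coeff f i ≈ coeff g i

  _+ₚ_ : Poly → Poly → Poly
  [] +ₚ g = g
  (a ∷ f) +ₚ [] = a ∷ f
  (a ∷ f) +ₚ (b ∷ g) = (a + b) ∷ (f +ₚ g)

  -ₚ_ : Poly → Poly
  -ₚ f = map -_ f

  _·ₚ_ : Carrier → Poly → Poly
  r ·ₚ f = map (r *_) f

  _*ₚ_ : Poly → Poly → Poly
  [] *ₚ g = []
  (a ∷ f) *ₚ g = (a ·ₚ g) +ₚ (0# ∷ (f *ₚ g))

  IsZeroPoly : Poly → Set ℓ
  IsZeroPoly f = ∀ i → coeff f i ≈ 0#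

  InMultiple : Carrier → Poly → Set (c ⊔ ℓ)
  InMultiple a f = ∃ λ h → f ≈ₚ (a ·ₚ h)

  Divides : Poly → Poly → Set (c ⊔ ℓ)
  Divides q f = ∃ λ h → f ≈ₚ (q *ₚ h)

  Monic : Poly → Set ℓ
  Monic q = ∃ λ n → (coeff q n ≈ 1#) × (∀ i → n < i → coeff q i ≈ 0#)

  -- Î = { r : p^k r = 0 }  (here `a` stands for the element p^k)
  Ann : Carrier → Pred Carrier ℓ
  Ann a r = a * r ≈ 0#

  PrincipalIdeal : Carrier → Pred Carrier (c ⊔ ℓ)
  PrincipalIdeal a r = ∃ λ s → r ≈ a * s

  IdealSum : ∀ {ℓ₁ ℓ₂} → Pred Carrier ℓ₁ → Pred Carrier ℓ₂ → Pred Carrier (c ⊔ ℓ ⊔ ℓ₁ ⊔ ℓ₂)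
  IdealSum I J r = ∃₂ λ a b → I a × J b × (r ≈ a + b)

  -- the image of q divides the image of f in (R/J)[x]:
  -- there is h ∈ R[x] with all coefficients of f - q*h in J
  DividesMod : ∀ {ℓ'} → Pred Carrier ℓ' → Poly → Poly → Set (c ⊔ ℓ')
  DividesMod J q f = ∃ λ h → ∀ i → J (coeff (f +ₚ (-ₚ (q *ₚ h))) i)

-- If the monic q divides g = pᵏ ĝ, say g = q h, then every coefficient of h lies in pᵏR.
-- Indeed, if q has leading coefficient 1 in degree n, then for h = a + x f the coefficients
-- of q h above degree n are those of q f shifted, while its degree-n coefficient is a plus
-- one of q f; so "all coefficients in an ideal" passes from q h to f, and then to a.
-- Writing h = pᵏ h', we get pᵏ (ĝ - q h') = g - q h = 0, so ĝ ≡ q h' modulo the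
-- annihilator Î of pᵏ, and a fortiori modulo Î + pR.
module Submission where

open import Defs
open import Algebra.Bundles using (CommutativeRing)
open import Data.Nat using (ℕ; _<_; _^_; suc)
open import Data.Nat.Primality using (Prime)
open import Relation.Nullary using (¬_)

open import Level using (_⊔_)
open import Data.Nat using (zero; _≤_; s≤s) renaming (_+_ to _+ℕ_)
open import Data.Nat.Properties using (m≤n+m)
open import Data.List using ([]; _∷_)
open import Data.Product using (_,_)
open import Relation.Unary using (Pred)
import Algebra.Properties.AbelianGroup as AbelianGroupProperties
import Algebra.Properties.CommutativeSemigroup as CommutativeSemigroupProperties
import Algebra.Properties.Ring as RingProperties
import Relation.Binary.Reasoning.Setoid as SetoidReasoning

module Polynomials {c ℓ} (R : CommutativeRing c ℓ) where
  open CommutativeRing R hiding (zero)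
  open RingDefs R
  open RingProperties ring using (-1*x≈-x; x[y-z]≈xy-xz)
  open AbelianGroupProperties +-abelianGroup using (//-rightDividesʳ)
  open CommutativeSemigroupProperties *-commutativeSemigroup using (x∙yz≈y∙xz)
  open CommutativeSemigroupProperties +-commutativeSemigroup using ()
    renaming (x∙yz≈y∙xz to x+[y+z]≈y+[x+z])
  open SetoidReasoning setoid

  coeff-+ₚ : ∀ f g i → coeff (f +ₚ g) i ≈ coeff f i + coeff g i
  coeff-+ₚ []      g       i       = sym (+-identityˡ _)
  coeff-+ₚ (a ∷ f) []      i       = sym (+-identityʳ _)
  coeff-+ₚ (a ∷ f) (b ∷ g) zero    = refl
  coeff-+ₚ (a ∷ f) (b ∷ g) (suc i) = coeff-+ₚ f g i

  coeff-·ₚ : ∀ r f i → coeff (r ·ₚ f) i ≈ r * coeff f i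
  coeff-·ₚ r []      i       = sym (zeroʳ r)
  coeff-·ₚ r (a ∷ f) zero    = refl
  coeff-·ₚ r (a ∷ f) (suc i) = coeff-·ₚ r f i

  coeff--ₚ : ∀ f i → coeff (-ₚ f) i ≈ - coeff f i
  coeff--ₚ []      i       = sym (trans (sym (+-identityˡ _)) (-‿inverseʳ 0#))
  coeff--ₚ (a ∷ f) zero    = refl
  coeff--ₚ (a ∷ f) (suc i) = coeff--ₚ f i

  coeff-*ₚ-∷ˡ : ∀ b q f i → coeff ((b ∷ q) *ₚ f) i ≈ b * coeff f i + coeff (0# ∷ (q *ₚ f)) i
  coeff-*ₚ-∷ˡ b q f i = trans (coeff-+ₚ (b ·ₚ f) _ i) (+-cong (coeff-·ₚ b f i) refl)

  coeff-*ₚ-∷ʳ : ∀ q a f i → coeff (q *ₚ (a ∷ f)) i ≈ a * coeff q i + coeff (0# ∷ (q *ₚ f)) i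
  coeff-*ₚ-∷ʳ []      a f zero    = sym (trans (+-identityʳ _) (zeroʳ a))
  coeff-*ₚ-∷ʳ []      a f (suc i) = sym (trans (+-identityʳ _) (zeroʳ a))
  coeff-*ₚ-∷ʳ (b ∷ q) a f zero    = +-cong (*-comm b a) refl
  coeff-*ₚ-∷ʳ (b ∷ q) a f (suc i) = begin
    coeff ((b ∷ q) *ₚ (a ∷ f)) (suc i)         ≈⟨ coeff-*ₚ-∷ˡ b q (a ∷ f) (suc i) ⟩
    b * coeff f i + coeff (q *ₚ (a ∷ f)) i     ≈⟨ +-cong refl (coeff-*ₚ-∷ʳ q a f i) ⟩
    b * coeff f i + (a * coeff q i + coeff (0# ∷ (q *ₚ f)) i)
                                               ≈⟨ x+[y+z]≈y+[x+z] _ _ _ ⟩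
    a * coeff q i + (b * coeff f i + coeff (0# ∷ (q *ₚ f)) i)
                                               ≈⟨ +-cong refl (coeff-*ₚ-∷ˡ b q f i) ⟨
    a * coeff q i + coeff ((b ∷ q) *ₚ f) i     ∎

  *ₚ-·ₚ : ∀ q r f f′ → f ≈ₚ (r ·ₚ f′) → (q *ₚ f) ≈ₚ (r ·ₚ (q *ₚ f′))
  *ₚ-·ₚ []      r f f′ f≈rf′ i = refl
  *ₚ-·ₚ (b ∷ q) r f f′ f≈rf′ i = begin
    coeff ((b ∷ q) *ₚ f) i                            ≈⟨ coeff-*ₚ-∷ˡ b q f i ⟩
    b * coeff f i + coeff (0# ∷ (q *ₚ f)) i           ≈⟨ +-cong (*-cong refl (trans (f≈rf′ i) (coeff-·ₚ r f′ i)))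
                                                                (shifted i) ⟩
    b * (r * coeff f′ i) + r * coeff (0# ∷ (q *ₚ f′)) i ≈⟨ +-cong (x∙yz≈y∙xz b r _) refl ⟩
    r * (b * coeff f′ i) + r * coeff (0# ∷ (q *ₚ f′)) i ≈⟨ distribˡ r _ _ ⟨
    r * (b * coeff f′ i + coeff (0# ∷ (q *ₚ f′)) i)   ≈⟨ *-cong refl (coeff-*ₚ-∷ˡ b q f′ i) ⟨
    r * coeff ((b ∷ q) *ₚ f′) i                       ≈⟨ coeff-·ₚ r ((b ∷ q) *ₚ f′) i ⟨
    coeff (r ·ₚ ((b ∷ q) *ₚ f′)) i                    ∎
    where
    shifted : ∀ i → coeff (0# ∷ (q *ₚ f)) i ≈ r * coeff (0# ∷ (q *ₚ f′)) i
    shifted zero    = sym (zeroʳ r)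
    shifted (suc i) = trans (*ₚ-·ₚ q r f f′ f≈rf′ i) (coeff-·ₚ r (q *ₚ f′) i)

  CoeffsIn : ∀ {ℓ′} → Pred Carrier ℓ′ → Poly → Set ℓ′
  CoeffsIn J f = ∀ i → J (coeff f i)

  CoeffsInFrom : ∀ {ℓ′} → Pred Carrier ℓ′ → ℕ → Poly → Set ℓ′
  CoeffsInFrom J n f = ∀ i → J (coeff f (i +ℕ n))

  module _ {J : Pred Carrier (c ⊔ ℓ)} (J-ideal : IsIdeal J) where
    open IsIdeal J-ideal

    -‿closed : ∀ {x} → J x → J (- x)
    -‿closed {x} x∈J = resp (-1*x≈-x x) (*-closed (- 1#) x∈J)

    CoeffsIn-0∷ : ∀ {f} → CoeffsIn J f → CoeffsIn J (0# ∷ f)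
    CoeffsIn-0∷ f∈J zero    = zero∈
    CoeffsIn-0∷ f∈J (suc i) = f∈J i

    CoeffsIn-*ₚ : ∀ q f → CoeffsIn J f → CoeffsIn J (q *ₚ f)
    CoeffsIn-*ₚ []      f f∈J i = zero∈
    CoeffsIn-*ₚ (b ∷ q) f f∈J i = resp (sym (coeff-*ₚ-∷ˡ b q f i))
      (+-closed (*-closed b (f∈J i)) (CoeffsIn-0∷ (CoeffsIn-*ₚ q f f∈J) i))

    module _ (q : Poly) (n : ℕ) (qₙ≈1 : coeff q n ≈ 1#) (q≈0-above : ∀ i → n < i → coeff q i ≈ 0#) where

      coeff-*ₚ-∷-above : ∀ a f {i} → n ≤ i → coeff (q *ₚ (a ∷ f)) (suc i) ≈ coeff (q *ₚ f) i
      coeff-*ₚ-∷-above a f {i} n≤i = begin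
        coeff (q *ₚ (a ∷ f)) (suc i)           ≈⟨ coeff-*ₚ-∷ʳ q a f (suc i) ⟩
        a * coeff q (suc i) + coeff (q *ₚ f) i ≈⟨ +-cong (trans (*-cong refl (q≈0-above (suc i) (s≤s n≤i))) (zeroʳ a)) refl ⟩
        0# + coeff (q *ₚ f) i                  ≈⟨ +-identityˡ _ ⟩
        coeff (q *ₚ f) i                       ∎

      coeff-*ₚ-∷-leading : ∀ a f → coeff (q *ₚ (a ∷ f)) n ≈ a + coeff (0# ∷ (q *ₚ f)) n
      coeff-*ₚ-∷-leading a f =
        trans (coeff-*ₚ-∷ʳ q a f n) (+-cong (trans (*-cong refl qₙ≈1) (*-identityʳ a)) refl)

      CoeffsInFrom-*ₚ-tail : ∀ a f → CoeffsInFrom J n (q *ₚ (a ∷ f)) → CoeffsInFrom J n (q *ₚ f)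
      CoeffsInFrom-*ₚ-tail a f qf∈J i = resp (coeff-*ₚ-∷-above a f (m≤n+m n i)) (qf∈J (suc i))

      -- The hypothesis only concerns degrees ≥ n, so that it survives dropping the constant term of f.
      CoeffsIn-cancel-monic : ∀ f → CoeffsInFrom J n (q *ₚ f) → CoeffsIn J f
      CoeffsIn-cancel-monic []      _   i       = zero∈
      CoeffsIn-cancel-monic (a ∷ f) qf∈J (suc i) = CoeffsIn-cancel-monic f (CoeffsInFrom-*ₚ-tail a f qf∈J) i
      CoeffsIn-cancel-monic (a ∷ f) qf∈J zero    = resp a≈ (+-closed (qf∈J 0) (-‿closed (rest n)))
        where
        rest : CoeffsIn J (0# ∷ (q *ₚ f))
        rest = CoeffsIn-0∷ (CoeffsIn-*ₚ q f (CoeffsIn-cancel-monic f (CoeffsInFrom-*ₚ-tail a f qf∈J)))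
        a≈ : coeff (q *ₚ (a ∷ f)) n - coeff (0# ∷ (q *ₚ f)) n ≈ a
        a≈ = trans (+-cong (coeff-*ₚ-∷-leading a f) refl) (//-rightDividesʳ _ a)

      CoeffsIn-*ₚ-monic⁻¹ : ∀ f → CoeffsIn J (q *ₚ f) → CoeffsIn J f
      CoeffsIn-*ₚ-monic⁻¹ f qf∈J = CoeffsIn-cancel-monic f (λ i → qf∈J (i +ℕ n))

  PrincipalIdeal-isIdeal : ∀ a → IsIdeal (PrincipalIdeal a)
  PrincipalIdeal-isIdeal a = record
    { resp     = λ { x≈y (s , x≈as) → s , trans (sym x≈y) x≈as }
    ; zero∈    = 0# , sym (zeroʳ a)
    ; +-closed = λ { (s , x≈as) (t , y≈at) → s + t , trans (+-cong x≈as y≈at) (sym (distribˡ a s t)) }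
    ; *-closed = λ { r (s , x≈as) → r * s , trans (*-cong refl x≈as) (x∙yz≈y∙xz r a s) }
    }

  InMultiple-of-CoeffsIn : ∀ a f → CoeffsIn (PrincipalIdeal a) f → InMultiple a f
  InMultiple-of-CoeffsIn a []      _    = [] , λ i → refl
  InMultiple-of-CoeffsIn a (b ∷ f) f∈aR =
    let (s , b≈as) = f∈aR 0
        (f′ , f≈af′) = InMultiple-of-CoeffsIn a f (λ i → f∈aR (suc i))
    in s ∷ f′ , λ { zero → b≈as ; (suc i) → f≈af′ i }

  InMultiple-of-monic-*ₚ : ∀ a q h → Monic q → InMultiple a (q *ₚ h) → InMultiple a h
  InMultiple-of-monic-*ₚ a q h (n , qₙ≈1 , q≈0-above) (f , qh≈af) =
    InMultiple-of-CoeffsIn a h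
      (CoeffsIn-*ₚ-monic⁻¹ (PrincipalIdeal-isIdeal a) q n qₙ≈1 q≈0-above h
        (λ i → coeff f i , trans (qh≈af i) (coeff-·ₚ a f i)))

  DividesMod-Ann : ∀ a f q h′ → (a ·ₚ f) ≈ₚ (a ·ₚ (q *ₚ h′)) → DividesMod (Ann a) q f
  DividesMod-Ann a f q h′ af≈aqh′ = h′ , λ i → begin
    a * coeff (f +ₚ (-ₚ (q *ₚ h′))) i       ≈⟨ *-cong refl (trans (coeff-+ₚ f _ i) (+-cong refl (coeff--ₚ (q *ₚ h′) i))) ⟩
    a * (coeff f i - coeff (q *ₚ h′) i)     ≈⟨ x[y-z]≈xy-xz a _ _ ⟩
    a * coeff f i - a * coeff (q *ₚ h′) i   ≈⟨ +-cong (sym (coeff-·ₚ a f i)) (-‿cong (sym (coeff-·ₚ a (q *ₚ h′) i))) ⟩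
    coeff (a ·ₚ f) i - coeff (a ·ₚ (q *ₚ h′)) i
                                            ≈⟨ +-cong (af≈aqh′ i) refl ⟩
    coeff (a ·ₚ (q *ₚ h′)) i - coeff (a ·ₚ (q *ₚ h′)) i
                                            ≈⟨ -‿inverseʳ _ ⟩
    0#                                      ∎

  monic-DividesMod-Ann : ∀ a f q → Monic q → Divides q (a ·ₚ f) → DividesMod (Ann a) q f
  monic-DividesMod-Ann a f q q-monic (h , af≈qh) =
    let (h′ , h≈ah′) = InMultiple-of-monic-*ₚ a q h q-monic (f , λ i → sym (af≈qh i))
    in DividesMod-Ann a f q h′ (λ i → trans (af≈qh i) (*ₚ-·ₚ q a h h′ h≈ah′ i))

  DividesMod-mono : ∀ {ℓ₁ ℓ₂} {J : Pred Carrier ℓ₁} {J′ : Pred Carrier ℓ₂} →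
                    (∀ x → J x → J′ x) → ∀ q f → DividesMod J q f → DividesMod J′ q f
  DividesMod-mono J⊆J′ q f (h , f-qh∈J) = h , λ i → J⊆J′ _ (f-qh∈J i)

lemma5 : ∀ {c ℓ} (R : CommutativeRing c ℓ) → let open RingDefs R in
    IsLocal → (p α : ℕ) → Prime p → 0 < α → HasChar (p ^ α) →
    (g : Poly) → ¬ IsZeroPoly g →
    (k : ℕ) → k < α → InMultiple (ℕ→R (p ^ k)) g → ¬ InMultiple (ℕ→R (p ^ suc k)) g →
    (ĝ : Poly) → g ≈ₚ (ℕ→R (p ^ k) ·ₚ ĝ) → ¬ InMultiple (ℕ→R p) ĝ →
    (q : Poly) → Monic q → Divides q g →
    DividesMod (IdealSum (Ann (ℕ→R (p ^ k))) (PrincipalIdeal (ℕ→R p))) q ĝ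
lemma5 R _ p _ _ _ _ g _ k _ _ _ ĝ g≈pᵏĝ _ q q-monic (h , g≈qh) =
  DividesMod-mono Î⊆Î+pR q ĝ (monic-DividesMod-Ann (ℕ→R (p ^ k)) ĝ q q-monic (h , pᵏĝ≈qh))
  where
  open CommutativeRing R
  open RingDefs R
  open Polynomials R

  pᵏĝ≈qh : (ℕ→R (p ^ k) ·ₚ ĝ) ≈ₚ (q *ₚ h)
  pᵏĝ≈qh i = trans (sym (g≈pᵏĝ i)) (g≈qh i)

  Î⊆Î+pR : ∀ x → Ann (ℕ→R (p ^ k)) x → IdealSum (Ann (ℕ→R (p ^ k))) (PrincipalIdeal (ℕ→R p)) x
  Î⊆Î+pR x x∈Î = x , 0# , x∈Î , (0# , sym (zeroʳ (ℕ→R p))) , sym (+-identityʳ x)
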